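{- Let $m\ge1$ and $n\ge2$. The number of interval-closed sets $I$ of $[m]\times[n]$ such that for each $a\in[m]$ there exists $b\in[n]$ with $(a,b)\in I$ is the Narayana number \[N(n+m,n)=\frac{1}{n}\binom{n+m}{n-1}\binom{n+m-1}{n-1}.\]
   Context: $[k]$ is the chain $1<\cdots<k$; $[m]\times[n]$ is the Cartesian product poset with $(a,b)\le(c,d)$ iff $a\le c$ and $b\le d$. A subset $I$ of a poset is interval-closed if whenever $x,y\in I$ and $x\le z\le y$, then $z\in I$. -}

module Defs where

open import Data.Nat using (ℕ; zero; suc; _*_; _∸_; _+_; NonZero)
open import Data.Nat.Combinatorics using (_C_)
open import Data.Bool using (Bool; true; false; _≟_)
open import Data.Fin using (Fin; _≤_; _≤?_)
open import Data.Fin.Properties using (all?; any?)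
open import Data.Vec using (Vec; []; _∷_; lookup)
open import Data.List using (List; []; _∷_; map; concatMap; length; filter)
open import Data.Product using (_×_; ∃; _,_)
open import Relation.Binary.PropositionalEquality using (_≡_)
open import Relation.Nullary using (Dec; yes; no)
open import Relation.Nullary.Decidable using (_×-dec_; _→-dec_)

-- A subset I of [m] × [n] is encoded as an m × n grid of booleans
-- (row a, column b); (a , b) ∈ I iff entry (a , b) is true.
-- Fin m / Fin n stand for the chains [m] / [n] (0-indexed, same order).
Grid : ℕ → ℕ → Set
Grid m n = Vec (Vec Bool n) m

_∈G_ : ∀ {m n} → Fin m × Fin n → Grid m n → Set
(a , b) ∈G I = lookup (lookup I a) b ≡ true

_≤P_ : ∀ {m n} → Fin m × Fin n → Fin m × Fin n → Set
(a , b) ≤P (c , d) = (a ≤ c) × (b ≤ d)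

IntervalClosed : ∀ {m n} → Grid m n → Set
IntervalClosed {m} {n} I =
  ∀ (x y z : Fin m × Fin n) → x ∈G I → y ∈G I → x ≤P z → z ≤P y → z ∈G I

MeetsEveryRow : ∀ {m n} → Grid m n → Set
MeetsEveryRow {m} {n} I = ∀ (a : Fin m) → ∃ λ (b : Fin n) → (a , b) ∈G I

∈G? : ∀ {m n} (x : Fin m × Fin n) (I : Grid m n) → Dec (x ∈G I)
∈G? (a , b) I = lookup (lookup I a) b ≟ true

≤P? : ∀ {m n} (x y : Fin m × Fin n) → Dec (x ≤P y)
≤P? (a , b) (c , d) = (a ≤? c) ×-dec (b ≤? d)

allPairs? : ∀ {m n p} {P : Fin m × Fin n → Set p} →
            (∀ x → Dec (P x)) → Dec (∀ x → P x)
allPairs? {P = P} P? with all? (λ a → all? (λ b → P? (a , b)))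
... | yes h = yes (λ { (a , b) → h a b })
... | no ¬h = no (λ h → ¬h (λ a b → h (a , b)))

IntervalClosed? : ∀ {m n} (I : Grid m n) → Dec (IntervalClosed I)
IntervalClosed? I =
  allPairs? λ x → allPairs? λ y → allPairs? λ z →
    ∈G? x I →-dec (∈G? y I →-dec (≤P? x z →-dec (≤P? z y →-dec ∈G? z I)))

MeetsEveryRow? : ∀ {m n} (I : Grid m n) → Dec (MeetsEveryRow I)
MeetsEveryRow? I = all? λ a → any? λ b → ∈G? (a , b) I

allVecs : (n : ℕ) → List (Vec Bool n)
allVecs zero = [] ∷ []
allVecs (suc n) = concatMap (λ v → (false ∷ v) ∷ (true ∷ v) ∷ []) (allVecs n)

allGrids : (m n : ℕ) → List (Grid m n)
allGrids zero n = [] ∷ []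
allGrids (suc m) n =
  concatMap (λ r → map (r ∷_) (allGrids m n)) (allVecs n)

countICS : ℕ → ℕ → ℕ
countICS m n =
  length (filter (λ I → IntervalClosed? I ×-dec MeetsEveryRow? I) (allGrids m n))

narayana : ℕ → (k : ℕ) → .{{NonZero k}} → ℕ
narayana N k = ((N C (k ∸ 1)) * ((N ∸ 1) C (k ∸ 1))) Data.Nat./ k

-- An interval-closed set meeting every row is a staircase: row a is a nonempty interval
-- [l_a , r_a] and both endpoints weakly decrease as a grows (a later row reaching beyond either
-- endpoint would, by convexity, force a point of the earlier row outside its interval); conversely
-- every such staircase is interval-closed. Classifying the staircases whose top row lies weakly
-- left of (a , b) by that top row gives G_{k+1}(a,b) = Σ_{l ≤ a} Σ_{l ≤ r ≤ b} G_k(l,r), G_0 = 1,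
-- solved by the Lindström–Gessel–Viennot determinant
--   G_{k+1}(a,b) = C(a+k+1,k+1) C(b+k+1,k+1) − C(a+k+1,k+2) C(b+k+1,k),
-- which follows by induction on k from the hockey-stick identity. At a = b = n − 1 the absorption
-- identity for binomial coefficients turns the determinant into the Narayana number.

module Submission where

open import Defs
open import Data.Bool using (Bool; true; false; _∧_; if_then_else_; T)
open import Data.Bool.Properties using (T?; ∧-zeroʳ; T-∧)
open import Data.Empty using (⊥-elim)
open import Data.Fin using (zero; suc; toℕ; fromℕ<)
open import Data.Fin.Properties using (toℕ-fromℕ<; toℕ≤pred[n])
open import Data.List using (List; []; _∷_; map; concatMap; length; filter; _++_)
open import Data.List.Properties using (map-++; map-cong; length-++; filter-++; filter-≐)
open import Data.Maybe using (Maybe; just; nothing; maybe′)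
import Data.Maybe as Maybe
open import Data.Maybe.Properties using (maybe′-map)
open import Data.Nat using (ℕ; zero; suc; _+_; _*_; _∸_; _/_; _≤_; _<_; _≤?_; _≤ᵇ_; z≤n; s≤s; s≤s⁻¹; z<s; s<s; >-nonZero)
open import Data.Nat.Combinatorics using (_C_; nCk+nC[k+1]≡[n+1]C[k+1]; nC1≡n; k>n⇒nCk≡0; nCk≡nC[n∸k])
open import Data.Nat.DivMod using (m*n/n≡m)
open import Data.Nat.ListAction using (sum)
open import Data.Nat.ListAction.Properties using (sum-++)
open import Data.Nat.Properties
open import Data.Nat.Tactic.RingSolver using (solve-∀)
open import Algebra.Properties.CommutativeSemigroup +-commutativeSemigroup
  using () renaming (interchange to +-interchange; xy∙z≈xz∙y to xy+z≡xz+y)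
open import Data.Product using (_×_; _,_; uncurry; proj₁; proj₂; ∃; ∃₂)
import Data.Product as Product
open import Data.Vec using (Vec; []; _∷_; lookup)
open import Function using (_∘_; id; Equivalence)
open import Relation.Binary.PropositionalEquality
open import Relation.Nullary.Decidable using (yes; no; dec-true; dec-false; _×-dec_)
open ≡-Reasoning

private
  variable
    X Y : Set

∑ : ℕ → (ℕ → ℕ) → ℕ
∑ zero    f = 0
∑ (suc n) f = f 0 + ∑ n (f ∘ suc)

∑-cong : ∀ n {f g : ℕ → ℕ} → (∀ {i} → i < n → f i ≡ g i) → ∑ n f ≡ ∑ n g
∑-cong zero    f≡g = refl
∑-cong (suc n) f≡g = cong₂ _+_ (f≡g z<s) (∑-cong n (f≡g ∘ s<s))

∑-zero : ∀ n {f : ℕ → ℕ} → (∀ i → f i ≡ 0) → ∑ n f ≡ 0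
∑-zero zero    f≡0 = refl
∑-zero (suc n) f≡0 = cong₂ _+_ (f≡0 0) (∑-zero n (f≡0 ∘ suc))

∑-const : ∀ n c → ∑ n (λ _ → c) ≡ n * c
∑-const zero    c = refl
∑-const (suc n) c = cong (c +_) (∑-const n c)

∑-suc : ∀ n f → ∑ (suc n) f ≡ ∑ n f + f n
∑-suc zero    f = +-comm (f 0) 0
∑-suc (suc n) f = trans (cong (f 0 +_) (∑-suc n (f ∘ suc))) (sym (+-assoc (f 0) _ _))

∑-distrib-+ : ∀ n f g → ∑ n (λ i → f i + g i) ≡ ∑ n f + ∑ n g
∑-distrib-+ zero    f g = refl
∑-distrib-+ (suc n) f g =
  trans (cong (f 0 + g 0 +_) (∑-distrib-+ n (f ∘ suc) (g ∘ suc))) (+-interchange (f 0) (g 0) _ _)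

*-distribˡ-∑ : ∀ n c f → ∑ n (λ i → c * f i) ≡ c * ∑ n f
*-distribˡ-∑ zero    c f = sym (*-zeroʳ c)
*-distribˡ-∑ (suc n) c f =
  trans (cong (c * f 0 +_) (*-distribˡ-∑ n c (f ∘ suc))) (sym (*-distribˡ-+ c (f 0) _))

*-distribʳ-∑ : ∀ n c f → ∑ n (λ i → f i * c) ≡ ∑ n f * c
*-distribʳ-∑ n c f = begin
  ∑ n (λ i → f i * c)  ≡⟨ ∑-cong n (λ {i} _ → *-comm (f i) c) ⟩
  ∑ n (λ i → c * f i)  ≡⟨ *-distribˡ-∑ n c f ⟩
  c * ∑ n f            ≡⟨ *-comm c _ ⟩
  ∑ n f * c            ∎

∑-cut : ∀ {n c} {f g : ℕ → ℕ} → c < n →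
        (∀ {i} → i ≤ c → f i ≡ g i) → (∀ {i} → c < i → f i ≡ 0) → ∑ n f ≡ ∑ (suc c) g
∑-cut {suc n} {zero}  _         f≡g f≡0 = cong₂ _+_ (f≡g z≤n) (∑-zero n (λ _ → f≡0 z<s))
∑-cut {suc n} {suc c} (s<s c<n) f≡g f≡0 = cong₂ _+_ (f≡g z≤n) (∑-cut c<n (f≡g ∘ s≤s) (f≡0 ∘ s<s))

∑-linear : ∀ n {f g h : ℕ → ℕ} → (∀ {i} → i < n → f i + g i ≡ h i) → ∑ n f + ∑ n g ≡ ∑ n h
∑-linear n {f} {g} f+g≡h = trans (sym (∑-distrib-+ n f g)) (∑-cong n f+g≡h)

hockey-stick : ∀ d x k → ∑ d (λ j → (j + x) C k) + x C suc k ≡ (d + x) C suc k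
hockey-stick zero    x k = refl
hockey-stick (suc d) x k = begin
  ∑ (suc d) g + x C suc k        ≡⟨ cong (_+ x C suc k) (∑-suc d g) ⟩
  (∑ d g + g d) + x C suc k      ≡⟨ xy+z≡xz+y (∑ d g) (g d) _ ⟩
  (∑ d g + x C suc k) + g d      ≡⟨ cong (_+ g d) (hockey-stick d x k) ⟩
  (d + x) C suc k + (d + x) C k  ≡⟨ +-comm _ (g d) ⟩
  (d + x) C k + (d + x) C suc k  ≡⟨ nCk+nC[k+1]≡[n+1]C[k+1] (d + x) k ⟩
  suc (d + x) C suc k            ∎
  where
  g : ℕ → ℕ
  g j = (j + x) C k

∑-C-upper : ∀ d {m k} → m ≤ k → ∑ d (λ l → (l + m) C k) ≡ (d + m) C suc k
∑-C-upper d {m} {k} m≤k = begin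
  ∑ d (λ l → (l + m) C k)              ≡⟨ +-identityʳ _ ⟨
  ∑ d (λ l → (l + m) C k) + 0          ≡⟨ cong (∑ d (λ l → (l + m) C k) +_) (k>n⇒nCk≡0 (s≤s m≤k)) ⟨
  ∑ d (λ l → (l + m) C k) + m C suc k  ≡⟨ hockey-stick d m k ⟩
  (d + m) C suc k                      ∎

[k+1]*[n+1]C[k+1]≡[n+1]*nCk : ∀ n k → suc k * (suc n C suc k) ≡ suc n * (n C k)
[k+1]*[n+1]C[k+1]≡[n+1]*nCk zero    zero    = refl
[k+1]*[n+1]C[k+1]≡[n+1]*nCk zero    (suc k) = *-zeroʳ (suc (suc k))
[k+1]*[n+1]C[k+1]≡[n+1]*nCk (suc n) zero    = begin
  suc (suc n) C 1 + 0  ≡⟨ +-identityʳ _ ⟩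
  suc (suc n) C 1      ≡⟨ nC1≡n (suc (suc n)) ⟩
  suc (suc n)          ≡⟨ *-identityʳ _ ⟨
  suc (suc n) * 1      ∎
[k+1]*[n+1]C[k+1]≡[n+1]*nCk (suc n) (suc k) = begin
  suc (suc k) * (suc (suc n) C suc (suc k))
    ≡⟨ cong (suc (suc k) *_) (nCk+nC[k+1]≡[n+1]C[k+1] (suc n) (suc k)) ⟨
  suc (suc k) * (A + B)
    ≡⟨ regroup k A B ⟩
  A + (suc k * A + suc (suc k) * B)
    ≡⟨ cong₂ (λ s t → A + (s + t)) ([k+1]*[n+1]C[k+1]≡[n+1]*nCk n k) ([k+1]*[n+1]C[k+1]≡[n+1]*nCk n (suc k)) ⟩
  A + (suc n * (n C k) + suc n * (n C suc k))
    ≡⟨ cong (A +_) (*-distribˡ-+ (suc n) (n C k) _) ⟨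
  A + suc n * (n C k + n C suc k)
    ≡⟨ cong (λ t → A + suc n * t) (nCk+nC[k+1]≡[n+1]C[k+1] n k) ⟩
  A + suc n * A ∎
  where
  A = suc n C suc k
  B = suc n C suc (suc k)
  regroup : ∀ k A B → suc (suc k) * (A + B) ≡ A + (suc k * A + suc (suc k) * B)
  regroup = solve-∀

[k+1]*[j+k]C[k+1]≡j*[j+k]Ck : ∀ j k → suc k * ((j + k) C suc k) ≡ j * ((j + k) C k)
[k+1]*[j+k]C[k+1]≡j*[j+k]Ck j k = +-cancelˡ-≡ (suc k * c) _ _ (begin
  suc k * c + suc k * ((j + k) C suc k)  ≡⟨ *-distribˡ-+ (suc k) c _ ⟨
  suc k * (c + (j + k) C suc k)          ≡⟨ cong (suc k *_) (nCk+nC[k+1]≡[n+1]C[k+1] (j + k) k) ⟩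
  suc k * (suc (j + k) C suc k)          ≡⟨ [k+1]*[n+1]C[k+1]≡[n+1]*nCk (j + k) k ⟩
  suc (j + k) * c                        ≡⟨ split j k c ⟩
  suc k * c + j * c                      ∎)
  where
  c = (j + k) C k
  split : ∀ j k c → suc (j + k) * c ≡ suc k * c + j * c
  split = solve-∀

-- The staircase recurrence and its determinant solution

cross-cancel : ∀ {s p q x y x′ y′} → s + q * x ≡ p * y → x + p ≡ x′ → y + q ≡ y′ → s + q * x′ ≡ p * y′
cross-cancel {s} {p} {q} {x} {y} h refl refl = begin
  s + q * (x + p)      ≡⟨ distribute s q x p ⟩
  (s + q * x) + q * p  ≡⟨ cong (_+ q * p) h ⟩
  p * y + q * p        ≡⟨ collect p y q ⟩
  p * (y + q)          ∎
  where
  distribute : ∀ s q x p → s + q * (x + p) ≡ (s + q * x) + q * p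
  distribute = solve-∀
  collect : ∀ p y q → p * y + q * p ≡ p * (y + q)
  collect = solve-∀

∑intervals≤ : ℕ → ℕ → (ℕ → ℕ → ℕ) → ℕ
∑intervals≤ a b f = ∑ (suc a) (λ l → ∑ (suc (b ∸ l)) (λ j → f l (l + j)))

module StaircaseRecurrence (n : ℕ) (G : ℕ → ℕ → ℕ → ℕ)
  (G-zero : ∀ a b → G 0 a b ≡ 1)
  (G-suc : ∀ k {a b} → a ≤ b → b < n → G (suc k) a b ≡ ∑intervals≤ a b (G k)) where

  closedForm : ∀ k {a b} → a ≤ b → b < n →
    G (suc k) a b + ((a + suc k) C suc (suc k)) * ((b + suc k) C k)
      ≡ ((a + suc k) C suc k) * ((b + suc k) C suc k)

  rowSum : ∀ k {l b} → l ≤ b → b < n →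
    ∑ (suc (b ∸ l)) (λ j → G k l (l + j)) + ((l + k) C suc k) * ((b + suc k) C k)
      ≡ ((l + k) C k) * ((b + suc k) C suc k)

  closedForm k {a} {b} a≤b b<n = begin
    G (suc k) a b + ∑Q * V
      ≡⟨ cong₂ (λ s t → s + t * V) (G-suc k a≤b b<n) (sym (∑-C-upper′ (n≤1+n k))) ⟩
    ∑ (suc a) row + ∑ (suc a) Q * V
      ≡⟨ cong (∑ (suc a) row +_) (*-distribʳ-∑ (suc a) V Q) ⟨
    ∑ (suc a) row + ∑ (suc a) (λ l → Q l * V)
      ≡⟨ ∑-linear (suc a) {row} (λ l<1+a → rowSum k (≤-trans (s≤s⁻¹ l<1+a) a≤b) b<n) ⟩
    ∑ (suc a) (λ l → P l * U)
      ≡⟨ *-distribʳ-∑ (suc a) U P ⟩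
    ∑ (suc a) P * U
      ≡⟨ cong (_* U) (∑-C-upper′ ≤-refl) ⟩
    ((a + suc k) C suc k) * U ∎
    where
    row P Q : ℕ → ℕ
    row l = ∑ (suc (b ∸ l)) (λ j → G k l (l + j))
    P l = (l + k) C k
    Q l = (l + k) C suc k
    U = (b + suc k) C suc k
    V = (b + suc k) C k
    ∑Q = (a + suc k) C suc (suc k)
    ∑-C-upper′ : ∀ {i} → k ≤ i → ∑ (suc a) (λ l → (l + k) C i) ≡ (a + suc k) C suc i
    ∑-C-upper′ {i} k≤i = trans (∑-C-upper (suc a) k≤i) (cong (λ t → t C suc i) (sym (+-suc a k)))

  rowSum zero {l} {b} l≤b _ = begin
    ∑ (suc (b ∸ l)) (λ j → G 0 l (l + j)) + ((l + 0) C 1) * 1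
      ≡⟨ cong (_+ ((l + 0) C 1) * 1) (∑-cong (suc (b ∸ l)) (λ {j} _ → G-zero l (l + j))) ⟩
    ∑ (suc (b ∸ l)) (λ _ → 1) + ((l + 0) C 1) * 1
      ≡⟨ cong₂ _+_ (trans (∑-const (suc (b ∸ l)) 1) (*-identityʳ (suc (b ∸ l)))) (*-identityʳ ((l + 0) C 1)) ⟩
    suc (b ∸ l) + (l + 0) C 1
      ≡⟨ cong (suc (b ∸ l) +_) (trans (nC1≡n (l + 0)) (+-identityʳ l)) ⟩
    suc (b ∸ l) + l
      ≡⟨ cong suc (m∸n+n≡m l≤b) ⟩
    suc b
      ≡⟨ trans (+-comm 1 b) (sym (nC1≡n (b + 1))) ⟩
    (b + 1) C 1
      ≡⟨ *-identityˡ _ ⟨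
    1 * ((b + 1) C 1) ∎
  rowSum (suc k) {l} {b} l≤b b<n =
    cross-cancel {row} {P} {Q} summed
      (endpoint (suc k) (hockey-stick d x k)) (endpoint (suc (suc k)) (hockey-stick d x (suc k)))
    where
    x = l + suc k
    d = suc (b ∸ l)
    row = ∑ d (λ j → G (suc k) l (l + j))
    P = x C suc k
    Q = x C suc (suc k)
    v u : ℕ → ℕ
    v j = (j + x) C k
    u j = (j + x) C suc k
    endpoint : ∀ i {s} → s ≡ (d + x) C i → s ≡ (b + suc (suc k)) C i
    endpoint i s≡ = trans s≡ (cong (λ t → t C i) (begin
      suc (b ∸ l + (l + suc k))  ≡⟨ cong suc (+-assoc (b ∸ l) l (suc k)) ⟨
      suc (b ∸ l + l + suc k)    ≡⟨ cong (λ t → suc (t + suc k)) (m∸n+n≡m l≤b) ⟩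
      suc (b + suc k)            ≡⟨ +-suc b (suc k) ⟨
      b + suc (suc k)            ∎))
    pointwise : ∀ {j} → j < d → G (suc k) l (l + j) + Q * v j ≡ P * u j
    pointwise {j} j<d = subst (λ t → G (suc k) l (l + j) + Q * (t C k) ≡ P * (t C suc k))
      (shift l j)
      (closedForm k (m≤m+n l j) (≤-<-trans l+j≤b b<n))
      where
      l+j≤b : l + j ≤ b
      l+j≤b = ≤-trans (+-monoʳ-≤ l (s≤s⁻¹ j<d)) (≤-reflexive (m+[n∸m]≡n l≤b))
      shift : ∀ l j → l + j + suc k ≡ j + (l + suc k)
      shift = solve-∀
    summed : row + Q * ∑ d v ≡ P * ∑ d u
    summed = begin
      row + Q * ∑ d v                ≡⟨ cong (row +_) (*-distribˡ-∑ d Q v) ⟨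
      row + ∑ d (λ j → Q * v j)      ≡⟨ ∑-linear d {λ j → G (suc k) l (l + j)} pointwise ⟩
      ∑ d (λ j → P * u j)            ≡⟨ *-distribˡ-∑ d P u ⟩
      P * ∑ d u                      ∎

narayana-from-determinant : ∀ p k {A} →
  A + ((p + suc k) C suc (suc k)) * ((p + suc k) C k) ≡ ((p + suc k) C suc k) * ((p + suc k) C suc k) →
  ((suc p + suc k) C p) * ((p + suc k) C p) / suc p ≡ A
narayana-from-determinant p k {A} det = begin
  ((suc x C p) * (x C p)) / suc p  ≡⟨ cong₂ (λ s t → (s * t) / suc p) (symmetry (m≤n⇒m≤1+n p≤x) suc[x∸p]) (symmetry p≤x (m+n∸m≡n p m)) ⟩
  (c′ * c) / suc p              ≡⟨ cong (_/ suc p) (*-cancelˡ-≡ (c′ * c) (A * suc p) (suc m) scaled) ⟩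
  (A * suc p) / suc p          ≡⟨ m*n/n≡m A (suc p) ⟩
  A                            ∎
  where
  m = suc k
  x = p + m
  c = x C m
  c′ = suc x C suc m
  U = x C suc m
  W = x C k
  p≤x : p ≤ x
  p≤x = m≤m+n p m
  suc[x∸p] : suc x ∸ p ≡ suc m
  suc[x∸p] = trans (+-∸-assoc 1 p≤x) (cong suc (m+n∸m≡n p m))
  symmetry : ∀ {y i j} → i ≤ y → y ∸ i ≡ j → y C i ≡ y C j
  symmetry {y} i≤y refl = nCk≡nC[n∸k] i≤y
  [m+1]U≡pc : suc m * U ≡ p * c
  [m+1]U≡pc = [k+1]*[j+k]C[k+1]≡j*[j+k]Ck p m
  mc≡[p+1]W : m * c ≡ suc p * W
  mc≡[p+1]W = subst (λ t → m * (t C m) ≡ suc p * (t C k)) (sym (+-suc p k)) ([k+1]*[j+k]C[k+1]≡j*[j+k]Ck (suc p) k)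
  [m+1]c′≡[x+1]c : suc m * c′ ≡ suc x * c
  [m+1]c′≡[x+1]c = [k+1]*[n+1]C[k+1]≡[n+1]*nCk x m
  -- after adding (p c)(m c), each side becomes (m + 1)(p + 1) c²
  scaled : suc m * (c′ * c) ≡ suc m * (A * suc p)
  scaled = sym (+-cancelʳ-≡ ((p * c) * (m * c)) _ _ (begin
    suc m * (A * suc p) + (p * c) * (m * c)      ≡⟨ cong₂ (λ s t → suc m * (A * suc p) + s * t) [m+1]U≡pc (sym mc≡[p+1]W) ⟨
    suc m * (A * suc p) + (suc m * U) * (suc p * W) ≡⟨ factor (suc m) (suc p) A U W ⟩
    suc m * suc p * (A + U * W)                  ≡⟨ cong (suc m * suc p *_) det ⟩
    suc m * suc p * (c * c)                      ≡⟨ expand p k c ⟩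
    suc x * c * c + (p * c) * (m * c)            ≡⟨ cong (λ t → t * c + (p * c) * (m * c)) [m+1]c′≡[x+1]c ⟨
    (suc m * c′) * c + (p * c) * (m * c)          ≡⟨ cong (_+ (p * c) * (m * c)) (*-assoc (suc m) c′ c) ⟩
    suc m * (c′ * c) + (p * c) * (m * c)          ∎))
    where
    factor : ∀ m′ p′ A U W → m′ * (A * p′) + (m′ * U) * (p′ * W) ≡ m′ * p′ * (A + U * W)
    factor = solve-∀
    expand : ∀ p k c → suc (suc k) * suc p * (c * c) ≡ suc (p + suc k) * c * c + (p * c) * (suc k * c)
    expand = solve-∀

-- Counting staircase grids row by row

≤ᵇ-true : ∀ {i a} → i ≤ a → (i ≤ᵇ a) ≡ true
≤ᵇ-true = dec-true (_ ≤? _)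

≤ᵇ-false : ∀ {i a} → a < i → (i ≤ᵇ a) ≡ false
≤ᵇ-false a<i = dec-false (_ ≤? _) (<⇒≱ a<i)

∑intervals : ℕ → (ℕ → ℕ → ℕ) → ℕ
∑intervals n f = ∑ n (λ l → ∑ (n ∸ l) (λ j → f l (l + j)))

∑intervals-restrict : ∀ {n a b} f → a ≤ b → b < n →
  ∑intervals n (λ l r → if (l ≤ᵇ a) ∧ (r ≤ᵇ b) then f l r else 0) ≡ ∑intervals≤ a b f
∑intervals-restrict {n} {a} {b} f a≤b b<n =
  ∑-cut (≤-<-trans a≤b b<n) row (λ {l} a<l → ∑-zero (n ∸ l) (λ j → outside-left {l} {l + j} a<l))
  where
  w : ℕ → ℕ → ℕ
  w l r = if (l ≤ᵇ a) ∧ (r ≤ᵇ b) then f l r else 0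
  inside : ∀ {l r} → l ≤ a → r ≤ b → w l r ≡ f l r
  inside {l} {r} l≤a r≤b =
    cong₂ (λ s t → if s ∧ t then f l r else 0) (≤ᵇ-true l≤a) (≤ᵇ-true r≤b)
  outside-left : ∀ {l r} → a < l → w l r ≡ 0
  outside-left {l} {r} a<l =
    cong (λ s → if s ∧ (r ≤ᵇ b) then f l r else 0) (≤ᵇ-false a<l)
  outside-right : ∀ {l r} → b < r → w l r ≡ 0
  outside-right {l} {r} b<r = cong (λ t → if t then f l r else 0)
    (trans (cong ((l ≤ᵇ a) ∧_) (≤ᵇ-false b<r)) (∧-zeroʳ (l ≤ᵇ a)))
  row : ∀ {l} → l ≤ a → ∑ (n ∸ l) (λ j → w l (l + j)) ≡ ∑ (suc (b ∸ l)) (λ j → f l (l + j))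
  row {l} l≤a = ∑-cut (∸-monoˡ-< b<n l≤b)
    (λ j≤b∸l → inside l≤a (≤-trans (+-monoʳ-≤ l j≤b∸l) (≤-reflexive (m+[n∸m]≡n l≤b))))
    (λ b∸l<j → outside-right (≤-trans (≤-reflexive (cong suc (sym (m+[n∸m]≡n l≤b)))) (+-monoʳ-< l b∸l<j)))
    where
    l≤b = ≤-trans l≤a a≤b

sum-map-+ : ∀ (f g : X → ℕ) xs → sum (map (λ x → f x + g x) xs) ≡ sum (map f xs) + sum (map g xs)
sum-map-+ f g []       = refl
sum-map-+ f g (x ∷ xs) = trans (cong (f x + g x +_) (sum-map-+ f g xs)) (+-interchange (f x) (g x) _ _)

sum-map-concatMap : ∀ (w : Y → ℕ) (h : X → List Y) xs →
                    sum (map w (concatMap h xs)) ≡ sum (map (λ x → sum (map w (h x))) xs)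
sum-map-concatMap w h []       = refl
sum-map-concatMap w h (x ∷ xs) = begin
  sum (map w (h x ++ concatMap h xs))               ≡⟨ cong sum (map-++ w (h x) _) ⟩
  sum (map w (h x) ++ map w (concatMap h xs))       ≡⟨ sum-++ (map w (h x)) _ ⟩
  sum (map w (h x)) + sum (map w (concatMap h xs))  ≡⟨ cong (sum (map w (h x)) +_) (sum-map-concatMap w h xs) ⟩
  sum (map w (h x)) + sum (map (λ x → sum (map w (h x))) xs) ∎

sum-allVecs-suc : ∀ n (w : Vec Bool (suc n) → ℕ) →
  sum (map w (allVecs (suc n))) ≡ sum (map (λ v → w (false ∷ v) + w (true ∷ v)) (allVecs n))
sum-allVecs-suc n w = trans (sum-map-concatMap w _ (allVecs n))
  (cong sum (map-cong (λ v → cong (w (false ∷ v) +_) (+-identityʳ (w (true ∷ v)))) (allVecs n)))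

allFalse : ∀ {n} → Vec Bool n → Bool
allFalse []          = true
allFalse (false ∷ v) = allFalse v
allFalse (true ∷ v)  = false

initialSegment : ∀ {n} → Vec Bool n → Maybe ℕ
initialSegment []          = just 0
initialSegment (false ∷ v) = if allFalse v then just 0 else nothing
initialSegment (true ∷ v)  = Maybe.map suc (initialSegment v)

rowInterval : ∀ {n} → Vec Bool n → Maybe (ℕ × ℕ)
rowInterval []          = nothing
rowInterval (false ∷ v) = Maybe.map (Product.map suc suc) (rowInterval v)
rowInterval (true ∷ v)  = Maybe.map (0 ,_) (initialSegment v)

sum-allFalse : ∀ n c → sum (map (λ v → if allFalse v then c else 0) (allVecs n)) ≡ c
sum-allFalse zero    c = +-identityʳ c
sum-allFalse (suc n) c = begin
  sum (map (λ v → if allFalse v then c else 0) (allVecs (suc n)))      ≡⟨ sum-allVecs-suc n _ ⟩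
  sum (map (λ v → (if allFalse v then c else 0) + 0) (allVecs n))      ≡⟨ cong sum (map-cong (λ v → +-identityʳ _) (allVecs n)) ⟩
  sum (map (λ v → if allFalse v then c else 0) (allVecs n))            ≡⟨ sum-allFalse n c ⟩
  c                                                                    ∎

sum-initialSegment : ∀ n g → sum (map (λ v → maybe′ g 0 (initialSegment v)) (allVecs n)) ≡ ∑ (suc n) g
sum-initialSegment zero    g = refl
sum-initialSegment (suc n) g = begin
  sum (map (λ v → maybe′ g 0 (initialSegment v)) (allVecs (suc n)))
    ≡⟨ sum-allVecs-suc n _ ⟩
  sum (map (λ v → maybe′ g 0 (if allFalse v then just 0 else nothing) + maybe′ g 0 (Maybe.map suc (initialSegment v))) (allVecs n))
    ≡⟨ cong sum (map-cong (λ v → cong₂ _+_ (maybe′-if (allFalse v)) (maybe′-map g 0 suc (initialSegment v))) (allVecs n)) ⟩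
  sum (map (λ v → (if allFalse v then g 0 else 0) + maybe′ (g ∘ suc) 0 (initialSegment v)) (allVecs n))
    ≡⟨ sum-map-+ _ _ (allVecs n) ⟩
  sum (map (λ v → if allFalse v then g 0 else 0) (allVecs n)) + sum (map (λ v → maybe′ (g ∘ suc) 0 (initialSegment v)) (allVecs n))
    ≡⟨ cong₂ _+_ (sum-allFalse n (g 0)) (sum-initialSegment n (g ∘ suc)) ⟩
  g 0 + ∑ (suc n) (g ∘ suc) ∎
  where
  maybe′-if : ∀ b → maybe′ g 0 (if b then just 0 else nothing) ≡ (if b then g 0 else 0)
  maybe′-if true  = refl
  maybe′-if false = refl

sum-rowInterval : ∀ n f → sum (map (λ v → maybe′ (uncurry f) 0 (rowInterval v)) (allVecs n)) ≡ ∑intervals n f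
sum-rowInterval zero    f = refl
sum-rowInterval (suc n) f = begin
  sum (map (λ v → maybe′ (uncurry f) 0 (rowInterval v)) (allVecs (suc n)))
    ≡⟨ sum-allVecs-suc n _ ⟩
  sum (map (λ v → maybe′ (uncurry f) 0 (Maybe.map (Product.map suc suc) (rowInterval v))
                  + maybe′ (uncurry f) 0 (Maybe.map (0 ,_) (initialSegment v))) (allVecs n))
    ≡⟨ cong sum (map-cong (λ v → cong₂ _+_ (maybe′-map (uncurry f) 0 _ (rowInterval v)) (maybe′-map (uncurry f) 0 _ (initialSegment v))) (allVecs n)) ⟩
  sum (map (λ v → maybe′ (uncurry f′) 0 (rowInterval v) + maybe′ (f 0) 0 (initialSegment v)) (allVecs n))
    ≡⟨ sum-map-+ _ _ (allVecs n) ⟩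
  sum (map (λ v → maybe′ (uncurry f′) 0 (rowInterval v)) (allVecs n)) + sum (map (λ v → maybe′ (f 0) 0 (initialSegment v)) (allVecs n))
    ≡⟨ cong₂ _+_ (sum-rowInterval n f′) (sum-initialSegment n (f 0)) ⟩
  ∑intervals n f′ + ∑ (suc n) (f 0)
    ≡⟨ +-comm (∑intervals n f′) _ ⟩
  ∑intervals (suc n) f ∎
  where
  f′ : ℕ → ℕ → ℕ
  f′ l r = f (suc l) (suc r)

count : (X → Bool) → List X → ℕ
count p xs = length (filter (T? ∘ p) xs)

count-false : (xs : List X) → count (λ _ → false) xs ≡ 0
count-false []       = refl
count-false (x ∷ xs) = count-false xs

count-∧ : ∀ c (p : X → Bool) xs → count (λ x → c ∧ p x) xs ≡ (if c then count p xs else 0)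
count-∧ true  p xs = refl
count-∧ false p xs = count-false xs

count-map : ∀ (p : Y → Bool) (g : X → Y) xs → count p (map g xs) ≡ count (p ∘ g) xs
count-map p g []       = refl
count-map p g (x ∷ xs) with p (g x)
... | true  = cong suc (count-map p g xs)
... | false = count-map p g xs

count-concatMap : ∀ (p : Y → Bool) (h : X → List Y) xs →
                  count p (concatMap h xs) ≡ sum (map (λ x → count p (h x)) xs)
count-concatMap p h []       = refl
count-concatMap p h (x ∷ xs) = begin
  length (filter (T? ∘ p) (h x ++ concatMap h xs))                  ≡⟨ cong length (filter-++ (T? ∘ p) (h x) _) ⟩
  length (filter (T? ∘ p) (h x) ++ filter (T? ∘ p) (concatMap h xs)) ≡⟨ length-++ (filter (T? ∘ p) (h x)) ⟩
  count p (h x) + count p (concatMap h xs)                          ≡⟨ cong (count p (h x) +_) (count-concatMap p h xs) ⟩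
  count p (h x) + sum (map (λ x → count p (h x)) xs)                ∎

descends? : ∀ {m n} → ℕ → ℕ → Grid m n → Bool
descends∷? : ∀ {m n} → ℕ → ℕ → Maybe (ℕ × ℕ) → Grid m n → Bool

descends? a b []      = true
descends? a b (v ∷ G) = descends∷? a b (rowInterval v) G

descends∷? a b nothing        G = false
descends∷? a b (just (l , r)) G = ((l ≤ᵇ a) ∧ (r ≤ᵇ b)) ∧ descends? l r G

count-descends-suc : ∀ m n a b → count (descends? a b) (allGrids (suc m) n)
  ≡ ∑intervals n (λ l r → if (l ≤ᵇ a) ∧ (r ≤ᵇ b) then count (descends? l r) (allGrids m n) else 0)
count-descends-suc m n a b = begin
  count (descends? a b) (concatMap (λ v → map (v ∷_) (allGrids m n)) (allVecs n))
    ≡⟨ count-concatMap (descends? a b) _ (allVecs n) ⟩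
  sum (map (λ v → count (descends? a b) (map (v ∷_) (allGrids m n))) (allVecs n))
    ≡⟨ cong sum (map-cong (λ v → trans (count-map _ (v ∷_) (allGrids m n)) (by-top-row (rowInterval v))) (allVecs n)) ⟩
  sum (map (λ v → maybe′ (uncurry w) 0 (rowInterval v)) (allVecs n))
    ≡⟨ sum-rowInterval n w ⟩
  ∑intervals n w ∎
  where
  w : ℕ → ℕ → ℕ
  w l r = if (l ≤ᵇ a) ∧ (r ≤ᵇ b) then count (descends? l r) (allGrids m n) else 0
  by-top-row : ∀ I → count (descends∷? a b I) (allGrids m n) ≡ maybe′ (uncurry w) 0 I
  by-top-row nothing        = count-false (allGrids m n)
  by-top-row (just (l , r)) = count-∧ ((l ≤ᵇ a) ∧ (r ≤ᵇ b)) (descends? l r) (allGrids m n)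

-- Interval-closed sets are staircases

record IsInterval {n} (v : Vec Bool n) (l r : ℕ) : Set where
  field
    l≤r      : l ≤ r
    r<n      : r < n
    ∈⇒within : ∀ {i} → lookup v i ≡ true → l ≤ toℕ i × toℕ i ≤ r
    within⇒∈ : ∀ {i} → l ≤ toℕ i → toℕ i ≤ r → lookup v i ≡ true

  point : ∀ {k} → l ≤ k → k ≤ r → ∃ λ i → toℕ i ≡ k × lookup v i ≡ true
  point l≤k k≤r = i , i≡k , within⇒∈ (≤-trans l≤k (≤-reflexive (sym i≡k))) (≤-trans (≤-reflexive i≡k) k≤r)
    where
    k<n = ≤-<-trans k≤r r<n
    i = fromℕ< k<n
    i≡k = toℕ-fromℕ< k<n

IsInterval-false∷ : ∀ {n} {v : Vec Bool n} {l r} → IsInterval v l r → IsInterval (false ∷ v) (suc l) (suc r)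
IsInterval-false∷ {n} {v} {l} {r} I = record
  { l≤r = s≤s l≤r ; r<n = s≤s r<n ; ∈⇒within = ∈⇒within′ ; within⇒∈ = within⇒∈′ }
  where
  open IsInterval I
  ∈⇒within′ : ∀ {i} → lookup (false ∷ v) i ≡ true → suc l ≤ toℕ i × toℕ i ≤ suc r
  ∈⇒within′ {suc i} i∈ = Product.map s≤s s≤s (∈⇒within i∈)
  within⇒∈′ : ∀ {i} → suc l ≤ toℕ i → toℕ i ≤ suc r → lookup (false ∷ v) i ≡ true
  within⇒∈′ {suc i} l≤i i≤r = within⇒∈ (s≤s⁻¹ l≤i) (s≤s⁻¹ i≤r)

IsInterval-true∷ : ∀ {n} {v : Vec Bool n} {k} → IsInterval (true ∷ v) 0 k → IsInterval (true ∷ true ∷ v) 0 (suc k)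
IsInterval-true∷ {n} {v} {k} I = record
  { l≤r = z≤n ; r<n = s≤s r<n ; ∈⇒within = ∈⇒within′ ; within⇒∈ = within⇒∈′ }
  where
  open IsInterval I
  ∈⇒within′ : ∀ {i} → lookup (true ∷ true ∷ v) i ≡ true → 0 ≤ toℕ i × toℕ i ≤ suc k
  ∈⇒within′ {zero}  _  = z≤n , z≤n
  ∈⇒within′ {suc i} i∈ = z≤n , s≤s (proj₂ (∈⇒within i∈))
  within⇒∈′ : ∀ {i} → 0 ≤ toℕ i → toℕ i ≤ suc k → lookup (true ∷ true ∷ v) i ≡ true
  within⇒∈′ {zero}  _ _   = refl
  within⇒∈′ {suc i} _ i≤k = within⇒∈ z≤n (s≤s⁻¹ i≤k)

allFalse-sound : ∀ {n} (v : Vec Bool n) {i} → allFalse v ≡ true → lookup v i ≢ true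
allFalse-sound (false ∷ v) {zero}  _ ()
allFalse-sound (false ∷ v) {suc i} e = allFalse-sound v e

allFalse-complete : ∀ {n} (v : Vec Bool n) → allFalse v ≡ false → ∃ λ i → lookup v i ≡ true
allFalse-complete (false ∷ v) e = Product.map suc id (allFalse-complete v e)
allFalse-complete (true ∷ v)  _ = zero , refl

IsInterval-head : ∀ {n} {v : Vec Bool n} → (∀ {i} → lookup v i ≢ true) → IsInterval (true ∷ v) 0 0
IsInterval-head {v = v} ∉ = record
  { l≤r = z≤n ; r<n = s≤s z≤n ; ∈⇒within = ∈⇒within′ ; within⇒∈ = within⇒∈′ }
  where
  ∈⇒within′ : ∀ {i} → lookup (true ∷ v) i ≡ true → 0 ≤ toℕ i × toℕ i ≤ 0
  ∈⇒within′ {zero}  _  = z≤n , z≤n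
  ∈⇒within′ {suc i} i∈ = ⊥-elim (∉ i∈)
  within⇒∈′ : ∀ {i} → 0 ≤ toℕ i → toℕ i ≤ 0 → lookup (true ∷ v) i ≡ true
  within⇒∈′ {zero} _ _ = refl

initialSegment-sound : ∀ {n} (v : Vec Bool n) {k} → initialSegment v ≡ just k → IsInterval (true ∷ v) 0 k
initialSegment-sound [] refl = IsInterval-head (λ { {()} })
initialSegment-sound (false ∷ v) eq with allFalse v in e
initialSegment-sound (false ∷ v) refl | true = IsInterval-head (λ {i} → ∉ {i})
  where
  ∉ : ∀ {i} → lookup (false ∷ v) i ≢ true
  ∉ {zero}  ()
  ∉ {suc i} = allFalse-sound v e
initialSegment-sound (true ∷ v) eq with initialSegment v in e
initialSegment-sound (true ∷ v) refl | just k = IsInterval-true∷ (initialSegment-sound v e)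

rowInterval-sound : ∀ {n} (v : Vec Bool n) {l r} → rowInterval v ≡ just (l , r) → IsInterval v l r
rowInterval-sound (false ∷ v) eq with rowInterval v in e
rowInterval-sound (false ∷ v) refl | just _ = IsInterval-false∷ (rowInterval-sound v e)
rowInterval-sound (true ∷ v) eq with initialSegment v in e
rowInterval-sound (true ∷ v) refl | just _ = initialSegment-sound v e

Convex : ∀ {n} → Vec Bool n → Set
Convex v = ∀ {i j k} → lookup v i ≡ true → lookup v k ≡ true → toℕ i ≤ toℕ j → toℕ j ≤ toℕ k → lookup v j ≡ true

Convex-tail : ∀ {n} {x} {v : Vec Bool n} → Convex (x ∷ v) → Convex v
Convex-tail convex i∈ k∈ i≤j j≤k = convex i∈ k∈ (s≤s i≤j) (s≤s j≤k)

initialSegment-complete : ∀ {n} (v : Vec Bool n) → Convex (true ∷ v) → ∃ λ k → initialSegment v ≡ just k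
initialSegment-complete []          _      = 0 , refl
initialSegment-complete (true ∷ v)  convex =
  Product.map suc (cong (Maybe.map suc)) (initialSegment-complete v (Convex-tail convex))
initialSegment-complete (false ∷ v) convex with allFalse v in e
... | true  = 0 , refl
... | false with allFalse-complete v e
...   | i , i∈ = ⊥-elim (false≢true (convex {zero} {suc zero} {suc (suc i)} refl i∈ z≤n (s≤s z≤n)))
  where
  false≢true : false ≢ true
  false≢true ()

rowInterval-complete : ∀ {n} (v : Vec Bool n) {i} → Convex v → lookup v i ≡ true → ∃ λ lr → rowInterval v ≡ just lr
rowInterval-complete (false ∷ v) {suc i} convex i∈ =
  Product.map (Product.map suc suc) (cong (Maybe.map (Product.map suc suc))) (rowInterval-complete v (Convex-tail convex) i∈)
rowInterval-complete (true ∷ v) convex _ =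
  Product.map (0 ,_) (cong (Maybe.map (0 ,_))) (initialSegment-complete v convex)

record Fits {m n} (a b : ℕ) (G : Grid m n) : Set where
  field
    column≤  : ∀ {c d} → (c , d) ∈G G → toℕ d ≤ b
    rowMeets : ∀ c → ∃ λ d → toℕ d ≤ a × (c , d) ∈G G

IntervalClosed-tail : ∀ {m n} {v : Vec Bool n} {G : Grid m n} → IntervalClosed (v ∷ G) → IntervalClosed G
IntervalClosed-tail closed (a , i) (c , k) (e , j) i∈ k∈ (a≤e , i≤j) (e≤c , j≤k) =
  closed (suc a , i) (suc c , k) (suc e , j) i∈ k∈ (s≤s a≤e , i≤j) (s≤s e≤c , j≤k)

IntervalClosed-head : ∀ {m n} {v : Vec Bool n} {G : Grid m n} → IntervalClosed (v ∷ G) → Convex v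
IntervalClosed-head closed {i} {j} {k} i∈ k∈ i≤j j≤k =
  closed (zero , i) (zero , k) (zero , j) i∈ k∈ (z≤n , i≤j) (z≤n , j≤k)

descends∷⁻ : ∀ {m n a b} (I : Maybe (ℕ × ℕ)) {G : Grid m n} → T (descends∷? a b I G) →
             ∃₂ λ l r → I ≡ just (l , r) × l ≤ a × r ≤ b × T (descends? l r G)
descends∷⁻ {a = a} {b} (just (l , r)) t with Equivalence.to T-∧ t
... | bounds , t′ with Equivalence.to T-∧ bounds
...   | l≤ᵇa , r≤ᵇb = l , r , refl , ≤ᵇ⇒≤ l a l≤ᵇa , ≤ᵇ⇒≤ r b r≤ᵇb , t′

descends∷⁺ : ∀ {m n a b l r} {G : Grid m n} → l ≤ a → r ≤ b → T (descends? l r G) → T (descends∷? a b (just (l , r)) G)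
descends∷⁺ l≤a r≤b t = Equivalence.from T-∧ (Equivalence.from T-∧ (≤⇒≤ᵇ l≤a , ≤⇒≤ᵇ r≤b) , t)

IntervalClosed-∷ : ∀ {m n l r} {v : Vec Bool n} {G : Grid m n} →
  IsInterval v l r → IntervalClosed G → Fits l r G → IntervalClosed (v ∷ G)
IntervalClosed-∷ {v = v} {G} I closedG fitsG = closed
  where
  open IsInterval I
  open Fits fitsG
  closed : IntervalClosed (v ∷ G)
  closed (zero , i) (zero , k) (zero , j) i∈ k∈ (_ , i≤j) (_ , j≤k) =
    within⇒∈ (≤-trans (proj₁ (∈⇒within i∈)) i≤j) (≤-trans j≤k (proj₂ (∈⇒within k∈)))
  closed (zero , i) (suc c , k) (zero , j) i∈ k∈ (_ , i≤j) (_ , j≤k) =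
    within⇒∈ (≤-trans (proj₁ (∈⇒within i∈)) i≤j) (≤-trans j≤k (column≤ k∈))
  closed (zero , i) (suc c , k) (suc e , j) i∈ k∈ (_ , i≤j) (e≤c , j≤k) with rowMeets e
  ... | g , g≤l , g∈ =
    closedG (e , g) (c , k) (e , j) g∈ k∈ (≤-refl , ≤-trans g≤l (≤-trans (proj₁ (∈⇒within i∈)) i≤j)) (s≤s⁻¹ e≤c , j≤k)
  closed (suc a , i) (suc c , k) (suc e , j) i∈ k∈ (a≤e , i≤j) (e≤c , j≤k) =
    closedG (a , i) (c , k) (e , j) i∈ k∈ (s≤s⁻¹ a≤e , i≤j) (s≤s⁻¹ e≤c , j≤k)
  closed (zero  , _) (zero , _) (suc _ , _) _ _ _        (() , _)
  closed (suc _ , _) _          (zero , _)  _ _ (() , _) _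
  closed (suc _ , _) (zero , _) (suc _ , _) _ _ _        (() , _)

Fits-∷ : ∀ {m n a b l r} {v : Vec Bool n} {G : Grid m n} →
  IsInterval v l r → l ≤ a → r ≤ b → Fits l r G → Fits a b (v ∷ G)
Fits-∷ {a = a} {b} {v = v} {G} I l≤a r≤b fitsG = record { column≤ = λ {c} → column≤′ {c} ; rowMeets = rowMeets′ }
  where
  open IsInterval I
  open Fits fitsG
  column≤′ : ∀ {c d} → (c , d) ∈G (v ∷ G) → toℕ d ≤ b
  column≤′ {zero}  d∈ = ≤-trans (proj₂ (∈⇒within d∈)) r≤b
  column≤′ {suc c} d∈ = ≤-trans (column≤ d∈) r≤b
  rowMeets′ : ∀ c → ∃ λ d → toℕ d ≤ a × (c , d) ∈G (v ∷ G)
  rowMeets′ zero with point ≤-refl l≤r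
  ... | d , d≡l , d∈ = d , ≤-trans (≤-reflexive d≡l) l≤a , d∈
  rowMeets′ (suc c) with rowMeets c
  ... | d , d≤l , d∈ = d , ≤-trans d≤l l≤a , d∈

-- a point of G right of column r, or a row of G lying entirely right of column l, would
-- by interval-closedness put a point of the top row v outside [l , r]
Fits-tail : ∀ {m n a b l r} {v : Vec Bool n} {G : Grid m n} →
  IntervalClosed (v ∷ G) → IsInterval v l r → Fits a b (v ∷ G) → Fits l r G
Fits-tail {l = l} {r} {v} {G} closed I fits = record { column≤ = λ {c} → column≤′ {c} ; rowMeets = rowMeets′ }
  where
  open IsInterval I
  column≤′ : ∀ {c k} → (c , k) ∈G G → toℕ k ≤ r
  column≤′ {c} {k} k∈ with point l≤r ≤-refl
  ... | i , i≡r , i∈ = ≮⇒≥ λ r<k → <⇒≱ r<k (proj₂ (∈⇒within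
    (closed (zero , i) (suc c , k) (zero , k) i∈ k∈ (z≤n , ≤-trans (≤-reflexive i≡r) (<⇒≤ r<k)) (z≤n , ≤-refl))))
  rowMeets′ : ∀ c → ∃ λ k → toℕ k ≤ l × (c , k) ∈G G
  rowMeets′ c with Fits.rowMeets fits (suc c)
  ... | k , _ , k∈ with toℕ k ≤? l
  ...   | yes k≤l = k , k≤l , k∈
  ...   | no  k≰l with point ≤-refl l≤r
  ...     | i , i≡l , i∈ = i , ≤-reflexive i≡l ,
    closed (zero , i) (suc c , k) (suc c , i) i∈ k∈ (z≤n , ≤-refl) (≤-refl , ≤-trans (≤-reflexive i≡l) (<⇒≤ (≰⇒> k≰l)))

descends-sound : ∀ {m n a b} (G : Grid m n) → T (descends? a b G) → IntervalClosed G × Fits a b G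
descends-sound [] _ = (λ { (() , _) }) , record { column≤ = λ { {()} } ; rowMeets = λ () }
descends-sound (v ∷ G) t with descends∷⁻ (rowInterval v) t
... | l , r , eq , l≤a , r≤b , t′ with descends-sound G t′
...   | closedG , fitsG = IntervalClosed-∷ I closedG fitsG , Fits-∷ I l≤a r≤b fitsG
  where
  I = rowInterval-sound v eq

descends-complete : ∀ {m n a b} (G : Grid m n) → IntervalClosed G → Fits a b G → T (descends? a b G)
descends-complete []      _      _    = _
descends-complete {a = a} {b} (v ∷ G) closed fits with Fits.rowMeets fits zero
... | d , d≤a , d∈ with rowInterval-complete v (IntervalClosed-head closed) d∈
...   | (l , r) , eq = subst (λ J → T (descends∷? a b J G)) (sym eq)
  (descends∷⁺ {G = G} l≤a r≤b (descends-complete G (IntervalClosed-tail closed) (Fits-tail closed I fits)))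
  where
  I = rowInterval-sound v eq
  open IsInterval I
  l≤a : l ≤ a
  l≤a = ≤-trans (proj₁ (∈⇒within d∈)) d≤a
  r≤b : r ≤ b
  r≤b with point l≤r ≤-refl
  ... | i , i≡r , i∈ = ≤-trans (≤-reflexive (sym i≡r)) (Fits.column≤ fits {zero} i∈)

MeetsEveryRow⇒Fits : ∀ {m p} {G : Grid m (suc p)} → MeetsEveryRow G → Fits p p G
MeetsEveryRow⇒Fits meets = record
  { column≤  = λ {_} {d} _ → toℕ≤pred[n] d
  ; rowMeets = λ c → Product.map₂ (λ {d} d∈ → toℕ≤pred[n] d , d∈) (meets c) }

countICS≡count-descends : ∀ m p → countICS m (suc p) ≡ count (descends? p p) (allGrids m (suc p))
countICS≡count-descends m p = cong length
  (filter-≐ (λ G → IntervalClosed? G ×-dec MeetsEveryRow? G) (T? ∘ descends? p p) ((λ {G} → to {G}) , λ {G} → from {G}) (allGrids m (suc p)))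
  where
  to : ∀ {G : Grid m (suc p)} → IntervalClosed G × MeetsEveryRow G → T (descends? p p G)
  to {G} (closed , meets) = descends-complete G closed (MeetsEveryRow⇒Fits meets)
  from : ∀ {G : Grid m (suc p)} → T (descends? p p G) → IntervalClosed G × MeetsEveryRow G
  from {G} t = Product.map₂ (λ fits c → Product.map₂ proj₂ (Fits.rowMeets fits c)) (descends-sound G t)

theorem4p4 : (m n : ℕ) → 1 ≤ m → (h : 2 ≤ n) →
    countICS m n ≡ narayana (n + m) n {{>-nonZero (≤-trans (n≤1+n 1) h)}}
-- 2 ≤ n only excludes n = 0: the count is Narayana for n = 1 as well
theorem4p4 zero    _       ()      _
theorem4p4 (suc _) zero    _       ()
theorem4p4 (suc k) (suc p) _       _ = begin
  countICS (suc k) (suc p)          ≡⟨ countICS≡count-descends (suc k) p ⟩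
  N (suc k) p p                     ≡⟨ narayana-from-determinant p k (closedForm k ≤-refl ≤-refl) ⟨
  narayana (suc p + suc k) (suc p)  ∎
  where
  N : ℕ → ℕ → ℕ → ℕ
  N m a b = count (descends? a b) (allGrids m (suc p))
  open StaircaseRecurrence (suc p) N (λ _ _ → refl)
    (λ j {a} {b} a≤b b<n → trans (count-descends-suc j (suc p) a b) (∑intervals-restrict (N j) a≤b b<n))
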